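{- For every integer $k\ge 6$, there are infinitely many (pairwise non-isomorphic) $k$-vertex-critical $(P_5,C_5)$-free graphs.
   Context: A graph $G$ is $k$-vertex-critical if $\chi(G)=k$ and $\chi(G-v)<k$ for every vertex $v$, where $\chi$ denotes the chromatic number. $P_5$ is the path on $5$ vertices and $C_5$ is the $5$-cycle. A graph is $(H_1,H_2)$-free if it contains no induced subgraph isomorphic to $H_1$ or $H_2$. -}

module Defs where

open import Data.Nat using (ℕ; zero; suc; _+_; _≤_; _<_)
open import Data.Bool using (Bool; true; false; _∨_; _∧_; T)
open import Data.Bool.Properties using (∨-comm)
open import Data.Fin using (Fin; toℕ; punchIn)
open import Data.Product using (Σ; ∃; _×_; _,_)
open import Function.Definitions using (Injective)
open import Relation.Binary.PropositionalEquality using (_≡_; _≢_; refl; cong; cong₂)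
open import Relation.Nullary using (¬_)

record Graph : Set where
  field
    n      : ℕ
    adj    : Fin n → Fin n → Bool
    sym    : ∀ i j → adj i j ≡ adj j i
    irrefl : ∀ i → adj i i ≡ false
open Graph public

delete : (G : Graph) → Fin (n G) → Graph
delete record { n = zero } ()
delete record { n = suc m ; adj = a ; sym = s ; irrefl = r } v = record
  { n = m
  ; adj = λ i j → a (punchIn v i) (punchIn v j)
  ; sym = λ i j → s (punchIn v i) (punchIn v j)
  ; irrefl = λ i → r (punchIn v i)
  }

Colorable : Graph → ℕ → Set
Colorable G k = Σ (Fin (n G) → Fin k) λ c →
  ∀ i j → adj G i j ≡ true → c i ≢ c j

ChromaticNumber : Graph → ℕ → Set
ChromaticNumber G k = Colorable G k × (∀ j → Colorable G j → k ≤ j)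

ChromaticLess : Graph → ℕ → Set
ChromaticLess G k = Σ ℕ λ j → j < k × Colorable G j

VertexCritical : ℕ → Graph → Set
VertexCritical k G = ChromaticNumber G k × (∀ v → ChromaticLess (delete G v) k)

InducedSubgraph : Graph → Graph → Set
InducedSubgraph H G = Σ (Fin (n H) → Fin (n G)) λ f →
  Injective _≡_ _≡_ f × (∀ i j → adj G (f i) (f j) ≡ adj H i j)

Isomorphic : Graph → Graph → Set
Isomorphic G H = Σ (Fin (n G) → Fin (n H)) λ f → Σ (Fin (n H) → Fin (n G)) λ g →
  (∀ x → g (f x) ≡ x) × (∀ y → f (g y) ≡ y) × (∀ i j → adj H (f i) (f j) ≡ adj G i j)

private
  step : ℕ → ℕ → Bool
  step i j = (suc i Data.Nat.≡ᵇ j) ∨ (suc j Data.Nat.≡ᵇ i)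

  step-irr : ∀ i → step i i ≡ false
  step-irr zero = refl
  step-irr (suc i) = step-irr i

  wrap : ℕ → ℕ → Bool
  wrap i j = ((i Data.Nat.≡ᵇ 0) ∧ (j Data.Nat.≡ᵇ 4)) ∨ ((j Data.Nat.≡ᵇ 0) ∧ (i Data.Nat.≡ᵇ 4))

P5 : Graph
P5 = record
  { n = 5
  ; adj = λ i j → step (toℕ i) (toℕ j)
  ; sym = λ i j → ∨-comm (suc (toℕ i) Data.Nat.≡ᵇ toℕ j) _
  ; irrefl = λ i → step-irr (toℕ i)
  }

C5 : Graph
C5 = record
  { n = 5
  ; adj = λ i j → step (toℕ i) (toℕ j) ∨ wrap (toℕ i) (toℕ j)
  ; sym = λ i j → cong₂ _∨_ (∨-comm (suc (toℕ i) Data.Nat.≡ᵇ toℕ j) _) (∨-comm ((toℕ i Data.Nat.≡ᵇ 0) ∧ (toℕ j Data.Nat.≡ᵇ 4)) _)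
  ; irrefl = c5irr
  }
  where
  open import Data.Fin using (zero; suc)
  c5irr : ∀ (i : Fin 5) → (step (toℕ i) (toℕ i) ∨ wrap (toℕ i) (toℕ i)) ≡ false
  c5irr zero = refl
  c5irr (suc zero) = refl
  c5irr (suc (suc zero)) = refl
  c5irr (suc (suc (suc zero))) = refl
  c5irr (suc (suc (suc (suc zero)))) = refl

P5C5Free : Graph → Set
P5C5Free G = ¬ InducedSubgraph P5 G × ¬ InducedSubgraph C5 G

{-# OPTIONS --safe #-}
module Submission where

-- The witnesses are the circular cliques K_{p/q} with p = (k - 1)q + 1, one for each q ≥ 1;
-- their orders differ, so they are pairwise non-isomorphic.  Colouring by blocks of q
-- consecutive vertices uses k colours, and k - 1 once a vertex is deleted; conversely k - 1
-- colours would force 0, 1, …, q into one colour class by a pigeonhole argument, although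
-- 0 ~ q.  Two vertices are non-adjacent iff one lies less than q steps clockwise from the
-- other.  An induced P5 or C5 yields a 4- or 5-cycle of non-edges whose chords are edges;
-- the chords force all its non-edges to point the same way round the circle, and then going
-- once round the cycle takes fewer than p steps but returns to the start, which is absurd.

open import Defs
open import Data.Nat using (ℕ; _≤_)
open import Data.Product using (_×_)
open import Relation.Binary.PropositionalEquality using (_≢_)
open import Relation.Nullary using (¬_)

open import Data.Bool using (true; false)
open import Data.Empty using (⊥)
open import Data.Fin using (Fin; toℕ; fromℕ<; punchIn; #_) renaming (zero to fzero; suc to fsuc)
open import Data.Fin.Properties
  using (toℕ<n; toℕ-fromℕ<; toℕ-injective; pigeonhole; cantor-schröder-bernstein)
open import Data.List using ([]; _∷_)
open import Data.Nat
  using ( zero; suc; _+_; _*_; _∸_; _<_; ∣_-_∣; NonZero; >-nonZero; >-nonZero⁻¹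
        ; z≤n; s≤s; s≤s⁻¹; s<s⁻¹; _≤?_; _<?_)
open import Data.Nat.DivMod
  using (_/_; _%_; m≡m%n+[m/n]*n; m%n<n; m/n*n≤m; m<n*o⇒m/o<n; m<n⇒m%n≡m; [m+kn]%n≡m%n)
open import Data.Nat.Properties
open import Data.Nat.Tactic.RingSolver using (solve; solve-∀)
open import Data.Product using (Σ; ∃; _,_; proj₁; proj₂; uncurry)
open import Data.Sum using (_⊎_; inj₁; inj₂; [_,_]; swap)
open import Function using (_∘_)
open import Function.Consequences.Propositional
  using (inverseʳ⇒injective; strictlyInverseʳ⇒inverseʳ)
open import Relation.Binary.PropositionalEquality
  using (_≡_; refl; trans; cong; subst; module ≡-Reasoning)
  renaming (sym to ≡-sym)
open import Relation.Nullary using (Dec; does; proof; yes; no; contradiction)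
open import Relation.Nullary.Decidable using (_×-dec_; map′; dec-true; dec-false)
open import Relation.Nullary.Reflects using (Reflects; invert)

m/o≡n/o⇒n∸m<o : ∀ m n {o} .{{_ : NonZero o}} → m / o ≡ n / o → n ∸ m < o
m/o≡n/o⇒n∸m<o m n {o} same = m<n+o⇒m∸n<o n m (begin-strict
  n                  ≡⟨ m≡m%n+[m/n]*n n o ⟩
  n % o + n / o * o  <⟨ +-monoˡ-< (n / o * o) (m%n<n n o) ⟩
  o + n / o * o      ≡⟨ cong (λ d → o + d * o) (≡-sym same) ⟩
  o + m / o * o      ≤⟨ +-monoʳ-≤ o (m/n*n≤m m o) ⟩
  o + m              ≡⟨ +-comm o m ⟩
  m + o              ∎)
  where open ≤-Reasoning

toℕ-punchIn : ∀ {n} (v : Fin (suc n)) (i : Fin n) →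
  toℕ i < toℕ v × toℕ (punchIn v i) ≡ toℕ i ⊎ toℕ v ≤ toℕ i × toℕ (punchIn v i) ≡ suc (toℕ i)
toℕ-punchIn fzero    i        = inj₂ (z≤n , refl)
toℕ-punchIn (fsuc v) fzero    = inj₁ (s≤s z≤n , refl)
toℕ-punchIn (fsuc v) (fsuc i) with toℕ-punchIn v i
... | inj₁ (i<v , eq) = inj₁ (s≤s i<v , cong suc eq)
... | inj₂ (v≤i , eq) = inj₂ (s≤s v≤i , cong suc eq)

isomorphic⇒order≡ : ∀ {G H} → Isomorphic G H → n G ≡ n H
isomorphic⇒order≡ (f , g , gf , fg , _) = cantor-schröder-bernstein
  (inverseʳ⇒injective {f⁻¹ = g} f (strictlyInverseʳ⇒inverseʳ f gf))
  (inverseʳ⇒injective {f⁻¹ = f} g (strictlyInverseʳ⇒inverseʳ g fg))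

infix 4 _≡_mod_

record _≡_mod_ (x y m : ℕ) : Set where
  constructor congruent
  field
    k l : ℕ
    eq  : x + k * m ≡ y + l * m

module _ {m : ℕ} where

  ≡⇒≡-mod : ∀ {x y} → x ≡ y → x ≡ y mod m
  ≡⇒≡-mod refl = congruent 0 0 refl

  ≡-mod-sym : ∀ {x y} → x ≡ y mod m → y ≡ x mod m
  ≡-mod-sym (congruent k l eq) = congruent l k (≡-sym eq)

  ≡-mod-trans : ∀ {x y z} → x ≡ y mod m → y ≡ z mod m → x ≡ z mod m
  ≡-mod-trans {x} {y} {z} (congruent k l eq) (congruent k′ l′ eq′) =
    congruent (k + k′) (l′ + l) (begin
      x + (k + k′) * m      ≡⟨ solve (x ∷ k ∷ k′ ∷ m ∷ []) ⟩
      (x + k * m) + k′ * m  ≡⟨ cong (_+ k′ * m) eq ⟩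
      (y + l * m) + k′ * m  ≡⟨ solve (y ∷ l ∷ k′ ∷ m ∷ []) ⟩
      (y + k′ * m) + l * m  ≡⟨ cong (_+ l * m) eq′ ⟩
      (z + l′ * m) + l * m  ≡⟨ solve (z ∷ l′ ∷ l ∷ m ∷ []) ⟩
      z + (l′ + l) * m      ∎)
    where open ≡-Reasoning

  +-congʳ-mod : ∀ {x y} t → x ≡ y mod m → x + t ≡ y + t mod m
  +-congʳ-mod {x} {y} t (congruent k l eq) = congruent k l (begin
    x + t + k * m  ≡⟨ solve (x ∷ t ∷ k ∷ m ∷ []) ⟩
    x + k * m + t  ≡⟨ cong (_+ t) eq ⟩
    y + l * m + t  ≡⟨ solve (y ∷ l ∷ t ∷ m ∷ []) ⟩
    y + t + l * m  ∎)
    where open ≡-Reasoning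

  +-cancelʳ-mod : ∀ {x y} t → x + t ≡ y + t mod m → x ≡ y mod m
  +-cancelʳ-mod {x} {y} t (congruent k l eq) = congruent k l (+-cancelʳ-≡ t _ _ (begin
    x + k * m + t  ≡⟨ solve (x ∷ k ∷ t ∷ m ∷ []) ⟩
    x + t + k * m  ≡⟨ eq ⟩
    y + t + l * m  ≡⟨ solve (y ∷ t ∷ l ∷ m ∷ []) ⟩
    y + l * m + t  ∎))
    where open ≡-Reasoning

  m+n≡m-mod-n : ∀ x → x + m ≡ x mod m
  m+n≡m-mod-n x = congruent 0 1 (solve (x ∷ m ∷ []))

  ≡-mod⇒≡ : ∀ {x y} → x < m → y < m → x ≡ y mod m → x ≡ y
  ≡-mod⇒≡ {x} {y} x<m y<m (congruent k l eq) = begin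
    x                ≡⟨ ≡-sym (m<n⇒m%n≡m x<m) ⟩
    x % m            ≡⟨ ≡-sym ([m+kn]%n≡m%n x k m) ⟩
    (x + k * m) % m  ≡⟨ cong (_% m) eq ⟩
    (y + l * m) % m  ≡⟨ [m+kn]%n≡m%n y l m ⟩
    y % m            ≡⟨ m<n⇒m%n≡m y<m ⟩
    y                ∎
    where
    open ≡-Reasoning
    instance
      m≢0 : NonZero m
      m≢0 = >-nonZero (≤-<-trans z≤n x<m)

  shift-source : ∀ {x y z t t′} → x + t ≡ y mod m → x + t′ ≡ z mod m → t ≤ t′ →
    y + (t′ ∸ t) ≡ z mod m
  shift-source {x} {t = t} {t′} xy xz t≤t′ =
    ≡-mod-trans (+-congʳ-mod (t′ ∸ t) (≡-mod-sym xy))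
      (≡-mod-trans (≡⇒≡-mod (trans (+-assoc x t _) (cong (x +_) (m+[n∸m]≡n t≤t′)))) xz)

  shift-target : ∀ {x y z t t′} → x + t ≡ z mod m → y + t′ ≡ z mod m → t ≤ t′ →
    y + (t′ ∸ t) ≡ x mod m
  shift-target {y = y} {t = t} {t′} xz yz t≤t′ = +-cancelʳ-mod t
    (≡-mod-trans (≡⇒≡-mod (trans (+-assoc y _ t) (cong (y +_) (m∸n+n≡m t≤t′))))
      (≡-mod-trans yz (≡-mod-sym xz)))

-- The circular clique K_{p/q}: vertices 0 … p - 1, with u ~ v iff q ≤ |u - v| ≤ p - q.
-- The order p is written suc N so that `delete` computes on it.
module CircularClique (N q : ℕ) .{{_ : NonZero q}} where

  p : ℕ
  p = suc N

  infix 4 _~_ _~?_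

  record _~_ (u v : Fin p) : Set where
    constructor adjacent
    field
      q≤distance   : q ≤ ∣ toℕ u - toℕ v ∣
      distance+q≤p : ∣ toℕ u - toℕ v ∣ + q ≤ p

  _~?_ : ∀ u v → Dec (u ~ v)
  u ~? v = map′ (uncurry adjacent) (λ a → _~_.q≤distance a , _~_.distance+q≤p a)
    (q ≤? ∣ toℕ u - toℕ v ∣ ×-dec ∣ toℕ u - toℕ v ∣ + q ≤? p)

  ~?-comm : ∀ u v → does (u ~? v) ≡ does (v ~? u)
  ~?-comm u v rewrite ∣-∣-comm (toℕ u) (toℕ v) = refl

  adjacent-at : ∀ {u v e} → ∣ toℕ u - toℕ v ∣ ≡ e → q ≤ e → e + q ≤ p → u ~ v
  adjacent-at refl = adjacent

  ~-sym : ∀ {u v} → u ~ v → v ~ u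
  ~-sym {u} {v} (adjacent q≤d d+q≤p) = adjacent-at (∣-∣-comm (toℕ v) (toℕ u)) q≤d d+q≤p

  ≁-refl : ∀ u → ¬ u ~ u
  ≁-refl u (adjacent q≤0 _) = <⇒≱ (>-nonZero⁻¹ q) (subst (q ≤_) (∣n-n∣≡0 (toℕ u)) q≤0)

  ~-+ : ∀ {u v d} → toℕ u + d ≡ toℕ v → q ≤ d → d + q ≤ p → u ~ v
  ~-+ {u} {d = d} u+d≡v =
    adjacent-at (trans (cong (∣ toℕ u -_∣) (≡-sym u+d≡v)) (∣m-m+n∣≡n (toℕ u) d))

  K : Graph
  K = record
    { n      = p
    ; adj    = λ u v → does (u ~? v)
    ; sym    = ~?-comm
    ; irrefl = λ u → dec-false (u ~? u) (≁-refl u)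
    }

  adj≡true⇒~ : ∀ {u v} → adj K u v ≡ true → u ~ v
  adj≡true⇒~ {u} {v} e = invert (subst (Reflects (u ~ v)) e (proof (u ~? v)))

  adj≡false⇒≁ : ∀ {u v} → adj K u v ≡ false → ¬ u ~ v
  adj≡false⇒≁ {u} {v} e = invert (subst (Reflects (u ~ v)) e (proof (u ~? v)))

  record Within (d : ℕ) (u v : Fin p) : Set where
    constructor within
    field
      offset   : ℕ
      offset<d : offset < d
      arrives  : toℕ u + offset ≡ toℕ v mod p

  Within-trans : ∀ {d e u v w} → Within d u v → Within e v w → Within (d + e) u w
  Within-trans {u = u} (within t t<d uv) (within t′ t′<e vw) =
    within (t + t′) (+-mono-< t<d t′<e)
      (≡-mod-trans (≡⇒≡-mod (≡-sym (+-assoc (toℕ u) t t′))) (≡-mod-trans (+-congʳ-mod t′ uv) vw))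

  offset-loop : ∀ x {t} → t < p → x + t ≡ x mod p → t ≡ 0
  offset-loop x t<p loop =
    ≡-mod⇒≡ t<p (s≤s z≤n) (+-cancelʳ-mod x (≡-mod-trans (≡⇒≡-mod (+-comm _ x)) loop))

  Within-antisym : ∀ {d e u v} → Within d u v → Within e v u → d + e ≤ p → u ≡ v
  Within-antisym {u = u} {v} uv@(within t _ u+t≡v) vu d+e≤p =
    toℕ-injective (≡-mod⇒≡ (toℕ<n u) (toℕ<n v) (subst (_≡ toℕ v mod p) (+-identityʳ (toℕ u))
      (subst (λ t → toℕ u + t ≡ toℕ v mod p) t≡0 u+t≡v)))
    where
    open Within (Within-trans uv vu) using (offset<d; arrives)
    t≡0 : t ≡ 0
    t≡0 = m+n≡0⇒m≡0 t (offset-loop (toℕ u) (<-≤-trans offset<d d+e≤p) arrives)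

  Within-common-target : ∀ {d u v w} → Within d u w → Within d v w → Within d u v ⊎ Within d v u
  Within-common-target (within t t<d uw) (within t′ t′<d vw) with ≤-total t t′
  ... | inj₁ t≤t′ = inj₂ (within (t′ ∸ t) (≤-<-trans (m∸n≤m t′ t) t′<d) (shift-target uw vw t≤t′))
  ... | inj₂ t′≤t = inj₁ (within (t ∸ t′) (≤-<-trans (m∸n≤m t t′) t<d) (shift-target vw uw t′≤t))

  Within-common-source : ∀ {d u v w} → Within d u v → Within d u w → Within d v w ⊎ Within d w v
  Within-common-source (within t t<d uv) (within t′ t′<d uw) with ≤-total t t′
  ... | inj₁ t≤t′ = inj₁ (within (t′ ∸ t) (≤-<-trans (m∸n≤m t′ t) t′<d) (shift-source uv uw t≤t′))
  ... | inj₂ t′≤t = inj₂ (within (t ∸ t′) (≤-<-trans (m∸n≤m t t′) t<d) (shift-source uw uv t′≤t))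

  congruent⇒distance : ∀ {x y t} → x < p → y < p → t < p → x + t ≡ y mod p →
    ∣ x - y ∣ ≡ t ⊎ ∣ x - y ∣ + t ≡ p
  congruent⇒distance {x} {y} {t} x<p y<p t<p x+t≡y with x + t <? p
  ... | yes x+t<p =
    inj₁ (trans (cong (∣ x -_∣) (≡-sym (≡-mod⇒≡ x+t<p y<p x+t≡y))) (∣m-m+n∣≡n x t))
  ... | no  x+t≮p = inj₂ (begin
    ∣ x - y ∣ + t  ≡⟨ cong (_+ t) (m≤n⇒∣n-m∣≡n∸m y≤x) ⟩
    x ∸ y + t      ≡⟨ +-cancelˡ-≡ y _ _ y+[x∸y+t]≡y+p ⟩
    p              ∎)
    where
    open ≡-Reasoning
    s+p≡x+t : x + t ∸ p + p ≡ x + t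
    s+p≡x+t = m∸n+n≡m (≮⇒≥ x+t≮p)
    s<p : x + t ∸ p < p
    s<p = +-cancelʳ-< p _ p (subst (_< p + p) (≡-sym s+p≡x+t) (+-mono-< x<p t<p))
    y+p≡x+t : y + p ≡ x + t
    y+p≡x+t = subst (λ s → s + p ≡ x + t) (≡-mod⇒≡ s<p y<p
      (≡-mod-trans (≡-mod-sym (m+n≡m-mod-n _)) (≡-mod-trans (≡⇒≡-mod s+p≡x+t) x+t≡y))) s+p≡x+t
    y≤x : y ≤ x
    y≤x = <⇒≤ (+-cancelʳ-< p y x (subst (_< x + p) (≡-sym y+p≡x+t) (+-monoʳ-< x t<p)))
    y+[x∸y+t]≡y+p : y + (x ∸ y + t) ≡ y + p
    y+[x∸y+t]≡y+p =
      trans (≡-sym (+-assoc y _ t)) (trans (cong (_+ t) (m+[n∸m]≡n y≤x)) (≡-sym y+p≡x+t))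

  Within⇒≁ : ∀ {u v} → Within q u v → ¬ u ~ v
  Within⇒≁ {u} {v} (within t t<q uv) (adjacent q≤d d+q≤p)
    with congruent⇒distance (toℕ<n u) (toℕ<n v) (<-≤-trans t<q (≤-trans (m≤n+m q _) d+q≤p)) uv
  ... | inj₁ d≡t   = <⇒≱ t<q (subst (q ≤_) d≡t q≤d)
  ... | inj₂ d+t≡p = <-irrefl d+t≡p (<-≤-trans (+-monoʳ-< ∣ toℕ u - toℕ v ∣ t<q) d+q≤p)

  comparable⇒≁ : ∀ {u v} → Within q u v ⊎ Within q v u → ¬ u ~ v
  comparable⇒≁ (inj₁ uv) = Within⇒≁ uv
  comparable⇒≁ (inj₂ vu) = Within⇒≁ vu ∘ ~-sym

  ≤∧≁⇒comparable : ∀ {u v} → toℕ u ≤ toℕ v → ¬ u ~ v → Within q u v ⊎ Within q v u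
  ≤∧≁⇒comparable {u} {v} u≤v ≁ with q ≤? ∣ toℕ u - toℕ v ∣
  ... | no  d≱q = inj₁ (within (toℕ v ∸ toℕ u) (subst (_< q) (m≤n⇒∣m-n∣≡n∸m u≤v) (≰⇒> d≱q))
                        (≡⇒≡-mod (m+[n∸m]≡n u≤v)))
  ... | yes q≤d = inj₂ (within (p ∸ e) (m<n+o⇒m∸n<o p e far)
                        (≡-mod-trans (≡⇒≡-mod round-trip) (m+n≡m-mod-n (toℕ u))))
    where
    e : ℕ
    e = toℕ v ∸ toℕ u
    far : p < e + q
    far = subst (λ d → p < d + q) (m≤n⇒∣m-n∣≡n∸m u≤v) (≰⇒> (≁ ∘ adjacent q≤d))
    e≤p : e ≤ p
    e≤p = ≤-trans (m∸n≤m (toℕ v) (toℕ u)) (<⇒≤ (toℕ<n v))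
    round-trip : toℕ v + (p ∸ e) ≡ toℕ u + p
    round-trip = begin
      toℕ v + (p ∸ e)        ≡⟨ cong (_+ (p ∸ e)) (≡-sym (m+[n∸m]≡n u≤v)) ⟩
      toℕ u + e + (p ∸ e)    ≡⟨ +-assoc (toℕ u) e (p ∸ e) ⟩
      toℕ u + (e + (p ∸ e))  ≡⟨ cong (toℕ u +_) (m+[n∸m]≡n e≤p) ⟩
      toℕ u + p              ∎
      where open ≡-Reasoning

  ≁⇒comparable : ∀ {u v} → ¬ u ~ v → Within q u v ⊎ Within q v u
  ≁⇒comparable {u} {v} ≁ with ≤-total (toℕ u) (toℕ v)
  ... | inj₁ u≤v = ≤∧≁⇒comparable u≤v ≁
  ... | inj₂ v≤u = swap (≤∧≁⇒comparable v≤u (≁ ∘ ~-sym))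

  propagate-forward : ∀ {u v w} → Within q u v → ¬ v ~ w → u ~ w → Within q v w
  propagate-forward uv ≁vw u~w with ≁⇒comparable ≁vw
  ... | inj₁ vw = vw
  ... | inj₂ wv = contradiction u~w (comparable⇒≁ (Within-common-target uv wv))

  propagate-backward : ∀ {u v w} → Within q v u → ¬ v ~ w → u ~ w → Within q w v
  propagate-backward vu ≁vw u~w with ≁⇒comparable ≁vw
  ... | inj₁ vw = contradiction u~w (comparable⇒≁ (Within-common-source vu vw))
  ... | inj₂ wv = wv

  no-4-antihole : ∀ {y₀ y₁ y₂ y₃} → 4 * q ≤ p → y₀ ≢ y₁ →
    ¬ y₀ ~ y₁ → ¬ y₁ ~ y₂ → ¬ y₂ ~ y₃ → ¬ y₃ ~ y₀ → y₀ ~ y₂ → y₁ ~ y₃ → ⊥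
  no-4-antihole {y₀} {y₁} {y₂} {y₃} 4q≤p y₀≢y₁ n₀₁ n₁₂ n₂₃ n₃₀ a₀₂ a₁₃ =
    [ forward , backward ] (≁⇒comparable n₀₁)
    where
    round-trip : q + (q + (q + q)) ≤ p
    round-trip = subst (λ d → q + (q + (q + d)) ≤ p) (+-identityʳ q) 4q≤p

    forward : Within q y₀ y₁ → ⊥
    forward w₀₁ = y₀≢y₁ (Within-antisym w₀₁ (Within-trans w₁₂ (Within-trans w₂₃ w₃₀)) round-trip)
      where
      w₁₂ : Within q y₁ y₂
      w₁₂ = propagate-forward w₀₁ n₁₂ a₀₂
      w₂₃ : Within q y₂ y₃
      w₂₃ = propagate-forward w₁₂ n₂₃ a₁₃
      w₃₀ : Within q y₃ y₀
      w₃₀ = propagate-forward w₂₃ n₃₀ (~-sym a₀₂)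

    backward : Within q y₁ y₀ → ⊥
    backward w₁₀ =
      y₀≢y₁ (≡-sym (Within-antisym w₁₀ (Within-trans w₀₃ (Within-trans w₃₂ w₂₁)) round-trip))
      where
      w₂₁ : Within q y₂ y₁
      w₂₁ = propagate-backward w₁₀ n₁₂ a₀₂
      w₃₂ : Within q y₃ y₂
      w₃₂ = propagate-backward w₂₁ n₂₃ a₁₃
      w₀₃ : Within q y₀ y₃
      w₀₃ = propagate-backward w₃₂ n₃₀ (~-sym a₀₂)

  no-5-antihole : ∀ {y₀ y₁ y₂ y₃ y₄} → 5 * q ≤ p → y₀ ≢ y₁ →
    ¬ y₀ ~ y₁ → ¬ y₁ ~ y₂ → ¬ y₂ ~ y₃ → ¬ y₃ ~ y₄ → ¬ y₄ ~ y₀ →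
    y₀ ~ y₂ → y₁ ~ y₃ → y₂ ~ y₄ → y₃ ~ y₀ → ⊥
  no-5-antihole {y₀} {y₁} {y₂} {y₃} {y₄} 5q≤p y₀≢y₁ n₀₁ n₁₂ n₂₃ n₃₄ n₄₀ a₀₂ a₁₃ a₂₄ a₃₀ =
    [ forward , backward ] (≁⇒comparable n₀₁)
    where
    round-trip : q + (q + (q + (q + q))) ≤ p
    round-trip = subst (λ d → q + (q + (q + (q + d))) ≤ p) (+-identityʳ q) 5q≤p

    forward : Within q y₀ y₁ → ⊥
    forward w₀₁ = y₀≢y₁ (Within-antisym w₀₁
      (Within-trans w₁₂ (Within-trans w₂₃ (Within-trans w₃₄ w₄₀))) round-trip)
      where
      w₁₂ : Within q y₁ y₂
      w₁₂ = propagate-forward w₀₁ n₁₂ a₀₂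
      w₂₃ : Within q y₂ y₃
      w₂₃ = propagate-forward w₁₂ n₂₃ a₁₃
      w₃₄ : Within q y₃ y₄
      w₃₄ = propagate-forward w₂₃ n₃₄ a₂₄
      w₄₀ : Within q y₄ y₀
      w₄₀ = propagate-forward w₃₄ n₄₀ a₃₀

    backward : Within q y₁ y₀ → ⊥
    backward w₁₀ = y₀≢y₁ (≡-sym (Within-antisym w₁₀
      (Within-trans w₀₄ (Within-trans w₄₃ (Within-trans w₃₂ w₂₁))) round-trip))
      where
      w₂₁ : Within q y₂ y₁
      w₂₁ = propagate-backward w₁₀ n₁₂ a₀₂
      w₃₂ : Within q y₃ y₂
      w₃₂ = propagate-backward w₂₁ n₂₃ a₁₃
      w₄₃ : Within q y₄ y₃
      w₄₃ = propagate-backward w₃₂ n₃₄ a₂₄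
      w₀₄ : Within q y₀ y₄
      w₀₄ = propagate-backward w₄₃ n₄₀ a₃₀

  edge-image : ∀ H ((f , _) : InducedSubgraph H K) i j → adj H i j ≡ true → f i ~ f j
  edge-image _ (f , _ , f-adj) i j e = adj≡true⇒~ (trans (f-adj i j) e)

  non-edge-image : ∀ H ((f , _) : InducedSubgraph H K) i j → adj H i j ≡ false → ¬ f i ~ f j
  non-edge-image _ (f , _ , f-adj) i j e = adj≡false⇒≁ (trans (f-adj i j) e)

  -- The complement of P5 contains the 4-cycle 0 3 1 4; that of C5 is the 5-cycle 0 2 4 1 3.
  P5-free : 4 * q ≤ p → ¬ InducedSubgraph P5 K
  P5-free 4q≤p emb@(_ , f-inj , _) = no-4-antihole 4q≤p (λ e → contradiction (f-inj e) λ ())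
    (non-edge-image P5 emb (# 0) (# 3) refl) (non-edge-image P5 emb (# 3) (# 1) refl)
    (non-edge-image P5 emb (# 1) (# 4) refl) (non-edge-image P5 emb (# 4) (# 0) refl)
    (edge-image P5 emb (# 0) (# 1) refl) (edge-image P5 emb (# 3) (# 4) refl)

  C5-free : 5 * q ≤ p → ¬ InducedSubgraph C5 K
  C5-free 5q≤p emb@(_ , f-inj , _) = no-5-antihole 5q≤p (λ e → contradiction (f-inj e) λ ())
    (non-edge-image C5 emb (# 0) (# 2) refl) (non-edge-image C5 emb (# 2) (# 4) refl)
    (non-edge-image C5 emb (# 4) (# 1) refl) (non-edge-image C5 emb (# 1) (# 3) refl)
    (non-edge-image C5 emb (# 3) (# 0) refl)
    (edge-image C5 emb (# 0) (# 4) refl) (edge-image C5 emb (# 2) (# 1) refl)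
    (edge-image C5 emb (# 4) (# 3) refl) (edge-image C5 emb (# 1) (# 0) refl)

  same-block⇒comparable : ∀ {s r r′ u v} → s + r ≡ toℕ u mod p → s + r′ ≡ toℕ v mod p →
    r / q ≡ r′ / q → Within q u v ⊎ Within q v u
  same-block⇒comparable {r = r} {r′} su sv same with ≤-total r r′
  ... | inj₁ r≤r′ =
    inj₁ (within (r′ ∸ r) (m/o≡n/o⇒n∸m<o r r′ same) (shift-source su sv r≤r′))
  ... | inj₂ r′≤r =
    inj₂ (within (r ∸ r′) (m/o≡n/o⇒n∸m<o r′ r (≡-sym same)) (shift-source sv su r′≤r))

  -- A vertex at position r, counted round the circle from s, gets colour ⌊r / q⌋.
  block-colouring : ∀ {n c} (vertex : Fin n → Fin p) (s : ℕ) →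
    (∀ i → ∃ λ r → r < c * q × s + r ≡ toℕ (vertex i) mod p) →
    Σ (Fin n → Fin c) λ colour → ∀ i j → vertex i ~ vertex j → colour i ≢ colour j
  block-colouring vertex s position = colour , proper
    where
    colour : Fin _ → Fin _
    colour i = fromℕ< (m<n*o⇒m/o<n (proj₁ (proj₂ (position i))))
    proper : ∀ i j → vertex i ~ vertex j → colour i ≢ colour j
    proper i j i~j same = comparable⇒≁
      (same-block⇒comparable (proj₂ (proj₂ (position i))) (proj₂ (proj₂ (position j))) block≡) i~j
      where
      block≡ : proj₁ (position i) / q ≡ proj₁ (position j) / q
      block≡ = trans (≡-sym (toℕ-fromℕ< _)) (trans (cong toℕ same) (toℕ-fromℕ< _))

  colorable : ∀ {c} → p ≤ c * q → Colorable K c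
  colorable p≤cq
    with block-colouring (λ u → u) 0 (λ u → toℕ u , <-≤-trans (toℕ<n u) p≤cq , ≡⇒≡-mod refl)
  ... | colour , proper = colour , λ u v e → proper u v (adj≡true⇒~ e)

  position-after : (v : Fin p) (i : Fin N) →
    ∃ λ r → r < N × suc (toℕ v) + r ≡ toℕ (punchIn v i) mod p
  position-after v i with toℕ-punchIn v i
  ... | inj₁ (i<v , punchIn≡i) = toℕ i + (N ∸ toℕ v) , r<N ,
    ≡-mod-trans (≡⇒≡-mod wraps) (≡-mod-trans (m+n≡m-mod-n (toℕ i)) (≡⇒≡-mod (≡-sym punchIn≡i)))
    where
    v≤N : toℕ v ≤ N
    v≤N = s≤s⁻¹ (toℕ<n v)
    r<N : toℕ i + (N ∸ toℕ v) < N
    r<N = subst (toℕ i + (N ∸ toℕ v) <_) (m+[n∸m]≡n v≤N) (+-monoˡ-< (N ∸ toℕ v) i<v)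
    swap-summands : ∀ a b c → suc a + (b + c) ≡ b + suc (a + c)
    swap-summands = solve-∀
    wraps : suc (toℕ v) + (toℕ i + (N ∸ toℕ v)) ≡ toℕ i + p
    wraps = trans (swap-summands (toℕ v) (toℕ i) (N ∸ toℕ v))
      (cong (λ n → toℕ i + suc n) (m+[n∸m]≡n v≤N))
  ... | inj₂ (v≤i , punchIn≡1+i) = toℕ i ∸ toℕ v , ≤-<-trans (m∸n≤m (toℕ i) (toℕ v)) (toℕ<n i) ,
    ≡⇒≡-mod (trans (cong suc (m+[n∸m]≡n v≤i)) (≡-sym punchIn≡1+i))

  delete-colorable : ∀ {c} → N ≤ c * q → (v : Fin p) → Colorable (delete K v) c
  delete-colorable N≤cq v with block-colouring (punchIn v) (suc (toℕ v)) position
    where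
    position : ∀ i → ∃ λ r → r < _ × suc (toℕ v) + r ≡ toℕ (punchIn v i) mod p
    position i with position-after v i
    ... | r , r<N , at = r , <-≤-trans r<N N≤cq , at
  ... | colour , proper = colour , λ i j e → proper i j (adj≡true⇒~ e)

  module LowerBound {c} (2q≤p : 2 * q ≤ p) (cq<p : c * q < p) (colouring : Colorable K c) where

    open Data.Product.Σ colouring renaming (proj₁ to col; proj₂ to proper)

    q+q≤p : q + q ≤ p
    q+q≤p = subst (λ d → q + d ≤ p) (+-identityʳ q) 2q≤p

    q<p : q < p
    q<p = <-≤-trans (m<m+n q (>-nonZero⁻¹ q)) q+q≤p

    colour : ∀ x → .(x < p) → Fin c
    colour x x<p = col (fromℕ< x<p)

    colour-cong : ∀ {x y} .(x<p : x < p) .(y<p : y < p) → x ≡ y → colour x x<p ≡ colour y y<p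
    colour-cong _ _ refl = refl

    colour-proper : ∀ {x y d} (x<p : x < p) (y<p : y < p) → x + d ≡ y → q ≤ d → d + q ≤ p →
      colour x x<p ≢ colour y y<p
    colour-proper x<p y<p x+d≡y q≤d d+q≤p = proper _ _ (dec-true (_ ~? _) (~-+ at q≤d d+q≤p))
      where
      at : toℕ (fromℕ< x<p) + _ ≡ toℕ (fromℕ< y<p)
      at = trans (cong (_+ _) (toℕ-fromℕ< x<p)) (trans x+d≡y (≡-sym (toℕ-fromℕ< y<p)))

    -- s followed by s + 1, s + 1 + q, …, s + 1 + (c - 1)q: c + 1 vertices whose only
    -- non-edge is {s, s + 1}, so that the pigeonhole principle puts s and s + 1 in one class.
    fan : ℕ → Fin (suc c) → ℕ
    fan s fzero    = s
    fan s (fsuc m) = suc s + toℕ m * q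

    fan<p : ∀ {s} → s < q → ∀ m → fan s m < p
    fan<p s<q fzero    = <-trans s<q q<p
    fan<p s<q (fsuc m) =
      ≤-<-trans (≤-trans (+-monoˡ-≤ (toℕ m * q) s<q) (*-monoˡ-≤ q (toℕ<n m))) cq<p

    colour-step : ∀ s (s<q : s < q) →
      colour s (<-trans s<q q<p) ≡ colour (suc s) (≤-<-trans s<q q<p)
    colour-step s s<q with pigeonhole (n<1+n c) (λ m → colour (fan s m) (fan<p s<q m))
    ... | fzero , fsuc fzero , _ , same =
      trans same (colour-cong (fan<p s<q (# 1)) (≤-<-trans s<q q<p) (+-identityʳ (suc s)))
    ... | fzero , fsuc (fsuc m) , _ , same =
      contradiction same (colour-proper (fan<p s<q fzero) (fan<p s<q (fsuc (fsuc m))) (+-suc s _)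
        (≤-trans (m≤m+n q _) (n≤1+n _))
        (subst (_≤ p) (cong suc (+-comm q _)) (≤-<-trans (*-monoˡ-≤ q (toℕ<n (fsuc m))) cq<p)))
    ... | fsuc a , fsuc b , a<b , same =
      contradiction same (colour-proper (fan<p s<q (fsuc a)) (fan<p s<q (fsuc b)) arrive q≤d d+q≤p)
      where
      a≤b : toℕ a ≤ toℕ b
      a≤b = <⇒≤ (s<s⁻¹ a<b)
      arrive : suc s + toℕ a * q + (toℕ b ∸ toℕ a) * q ≡ suc s + toℕ b * q
      arrive = trans (+-assoc (suc s) _ _) (cong (suc s +_)
        (trans (≡-sym (*-distribʳ-+ q (toℕ a) _)) (cong (_* q) (m+[n∸m]≡n a≤b))))
      q≤d : q ≤ (toℕ b ∸ toℕ a) * q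
      q≤d = subst (_≤ (toℕ b ∸ toℕ a) * q) (*-identityˡ q) (*-monoˡ-≤ q (m<n⇒0<n∸m (s<s⁻¹ a<b)))
      d+q≤p : (toℕ b ∸ toℕ a) * q + q ≤ p
      d+q≤p = subst (_≤ p) (+-comm q _)
        (≤-trans (*-monoˡ-≤ q (≤-trans (s≤s (m∸n≤m (toℕ b) (toℕ a))) (toℕ<n b))) (<⇒≤ cq<p))

    colour-0≡ : ∀ s (s≤q : s ≤ q) → colour 0 (≤-<-trans z≤n q<p) ≡ colour s (≤-<-trans s≤q q<p)
    colour-0≡ zero    _   = refl
    colour-0≡ (suc s) s<q = trans (colour-0≡ s (<⇒≤ s<q)) (colour-step s s<q)

  ¬colorable : ∀ {c} → 2 * q ≤ p → c * q < p → ¬ Colorable K c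
  ¬colorable 2q≤p cq<p colouring =
    colour-proper (≤-<-trans z≤n q<p) q<p refl ≤-refl q+q≤p (colour-0≡ q ≤-refl)
    where open LowerBound 2q≤p cq<p colouring

m*q≤1+k*q : ∀ {m k} q → m ≤ k → m * q ≤ suc (k * q)
m*q≤1+k*q q m≤k = ≤-trans (*-monoˡ-≤ q m≤k) (n≤1+n _)

circularClique : ∀ k q .{{_ : NonZero q}} → Graph
circularClique k q = CircularClique.K (k * q) q

circularClique-critical : ∀ k q .{{_ : NonZero q}} → 2 ≤ k →
  VertexCritical (suc k) (circularClique k q)
circularClique-critical k q 2≤k =
  (colorable p≤[1+k]q , lower-bound) , λ v → k , n<1+n k , delete-colorable ≤-refl v
  where
  open CircularClique (k * q) q
  p≤[1+k]q : p ≤ suc k * q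
  p≤[1+k]q = +-monoˡ-≤ (k * q) (>-nonZero⁻¹ q)
  lower-bound : ∀ j → Colorable K j → suc k ≤ j
  lower-bound j colouring with suc k ≤? j
  ... | yes k<j = k<j
  ... | no  k≮j = contradiction colouring
    (¬colorable (m*q≤1+k*q q 2≤k) (s≤s (*-monoˡ-≤ q (s≤s⁻¹ (≰⇒> k≮j)))))

circularClique-P5C5-free : ∀ k q .{{_ : NonZero q}} → 5 ≤ k → P5C5Free (circularClique k q)
circularClique-P5C5-free k q 5≤k =
  P5-free (m*q≤1+k*q q (≤-trans (n≤1+n 4) 5≤k)) , C5-free (m*q≤1+k*q q 5≤k)
  where open CircularClique (k * q) q

circularClique-injective : ∀ {k} .{{_ : NonZero k}} {i j} →
  Isomorphic (circularClique k (suc i)) (circularClique k (suc j)) → i ≡ j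
circularClique-injective {k} {i} {j} iso =
  suc-injective (*-cancelˡ-≡ (suc i) (suc j) k (suc-injective orders≡))
  where
  orders≡ : suc (k * suc i) ≡ suc (k * suc j)
  orders≡ = isomorphic⇒order≡ {circularClique k (suc i)} {circularClique k (suc j)} iso

corollary2p8 : (k : ℕ) → 6 ≤ k →
    Data.Product.Σ (ℕ → Graph) λ G →
      (∀ i → VertexCritical k (G i) × P5C5Free (G i)) ×
      (∀ i j → i ≢ j → ¬ Isomorphic (G i) (G j))
corollary2p8 (suc k) (s≤s 5≤k) =
  G , (λ i → circularClique-critical k (suc i) 2≤k , circularClique-P5C5-free k (suc i) 5≤k) ,
  λ i j i≢j → i≢j ∘ circularClique-injective {{>-nonZero (≤-<-trans z≤n 2≤k)}}
  where
  2≤k : 2 ≤ k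
  2≤k = ≤-trans (s≤s (s≤s z≤n)) 5≤k
  G : ℕ → Graph
  G i = circularClique k (suc i)
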